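{- Let $d \geq 3$ be a fixed integer. There exist a graph $G$ and two distance-$d$ independent sets $I, J$ of $G$ with $|I| = |J| = k \geq 2$ such that there is no $\mathsf{TS}$-sequence between $I$ and $J$ in $G$ (with respect to distance-$d$ independent sets of $G$), while there is a $\mathsf{TS}$-sequence between $I$ and $J$ in the graph $G^{d-1}$ with respect to independent sets of $G^{d-1}$. That is, $(G,I,J,\mathsf{TS})$ is a no-instance of \textsc{D$d$ISR} while $(G^{d-1},I,J,\mathsf{TS})$ is a yes-instance of \textsc{ISR}.
   Context: All graphs are simple and undirected. For $s \geq 1$, the $s$th power $G^s$ has vertex set $V(G)$ with distinct $u,v$ adjacent iff $\mathrm{dist}_G(u,v) \leq s$. For $d \geq 2$, a distance-$d$ independent set (D$d$IS) of $G$ is a set $I \subseteq V(G)$ with $\mathrm{dist}_G(u,v) \geq d$ for all distinct $u,v \in I$; a D$2$IS is an independent set, and $I$ is a D$d$IS of $G$ iff it is an independent set of $G^{d-1}$. A $\mathsf{TS}$-sequence in a graph $H$ between D$d$ISs $I, J$ of $H$ is a sequence $I = I_0, \dots, I_q = J$ of D$d$ISs of $H$ such that for each $i$, $I_i \setminus I_{i+1} = \{x_i\}$, $I_{i+1} \setminus I_i = \{y_i\}$ and $x_iy_i \in E(H)$. \textsc{D$d$ISR} under $\mathsf{TS}$ asks whether such a sequence exists; \textsc{ISR} is the case $d=2$. -}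

module Defs where

open import Data.Nat using (ℕ; zero; suc; _≤_)
open import Data.Fin using (Fin)
open import Data.Fin.Subset using (Subset; _∈_; _─_; ⁅_⁆)
open import Data.Product using (Σ; ∃; _×_)
open import Relation.Nullary using (¬_)
open import Relation.Binary.PropositionalEquality using (_≡_; _≢_)

record Graph : Set₁ where
  field
    n       : ℕ
    Adj     : Fin n → Fin n → Set
    sym     : ∀ {u v} → Adj u v → Adj v u
    irrefl  : ∀ {u} → ¬ Adj u u

open Graph public

data Walk (G : Graph) : ℕ → Fin (n G) → Fin (n G) → Set where
  here : ∀ {u} → Walk G zero u u
  cons : ∀ {k u w v} → Adj G u w → Walk G k w v → Walk G (suc k) u v

DistLE : (G : Graph) → ℕ → Fin (n G) → Fin (n G) → Set
DistLE G s u v = ∃ λ k → k ≤ s × Walk G k u v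

Power : Graph → ℕ → Graph
Power G s = record
  { n = n G
  ; Adj = λ u v → (u ≢ v) × DistLE G s u v
  ; sym = λ { (u≢v , k , k≤s , w) → (λ e → u≢v (Data.Product.proj₁ (eqsym e))) , k , k≤s , rev w }
  ; irrefl = λ { (u≢u , _) → u≢u Relation.Binary.PropositionalEquality.refl }
  }
  where
  open import Relation.Binary.PropositionalEquality using (refl; sym)
  open import Data.Product using (_,_; proj₁)
  open import Data.Unit using (⊤; tt)
  eqsym : ∀ {A : Set} {x y : A} → x ≡ y → (y ≡ x) × ⊤
  eqsym refl = refl , tt
  open import Data.Nat using (_+_)
  snoc : ∀ {k u w v} → Walk G k u w → Adj G w v → Walk G (suc k) u v
  snoc here a = cons a here
  snoc (cons a w) b = cons a (snoc w b)
  rev : ∀ {k u v} → Walk G k u v → Walk G k v u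
  rev here = here
  rev (cons a w) = snoc (rev w) (Graph.sym G a)

DdIS : (G : Graph) → ℕ → Subset (n G) → Set
DdIS G d I = ∀ {u v} → u ∈ I → v ∈ I → u ≢ v → ¬ DistLE G (d Data.Nat.∸ 1) u v

IS : (H : Graph) → Subset (n H) → Set
IS H I = ∀ {u v} → u ∈ I → v ∈ I → ¬ Adj H u v

TSStep : (H : Graph) → Subset (n H) → Subset (n H) → Set
TSStep H I I' = Σ (Fin (n H)) λ x → Σ (Fin (n H)) λ y →
  ((I ─ I') ≡ ⁅ x ⁆) × ((I' ─ I) ≡ ⁅ y ⁆) × Adj H x y

data TSSeq (H : Graph) (P : Subset (n H) → Set) : Subset (n H) → Subset (n H) → Set where
  done : ∀ {I} → P I → TSSeq H P I I
  step : ∀ {I I' J} → P I → TSStep H I I' → TSSeq H P I' J → TSSeq H P I J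

-- In G, a path of length d − 1 from a root up to a vertex carrying two leaves, the sets {leaf₁, root}
-- and {leaf₂, root} are distance-d independent, and neither token can move: sliding a leaf token down,
-- or the root token up, leaves two tokens at distance exactly d − 1.  In G^{d−1} the two leaves
-- (at distance 2 ≤ d − 1) are adjacent, so the leaf token slides across in one step.
module Submission where

open import Defs hiding (sym)
open import Data.Nat using (ℕ; zero; suc; _+_; _∸_; _≤_; z≤n; s≤s; z<s; ∣_-_∣)
open import Data.Nat.Properties
  using (≤-refl; ≤-reflexive; ≤-trans; ≤-pred; <-irrefl; 1+n≰n; n≤1+n; m<m+n; suc-injective; +-suc;
         +-identityʳ; 0≢1+n; m∸n+n≡m; m+n∸n≡m; ∣n-n∣≡0; ∣-∣-comm; ∣-∣-identityʳ; ∣-∣-triangle;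
         m≤n⇒∣n-m∣≡n∸m)
open import Data.Fin using (Fin; toℕ; fromℕ<) renaming (zero to fzero; suc to fsuc)
open import Data.Fin.Properties using (toℕ-injective; toℕ<n; toℕ-fromℕ<)
open import Data.Fin.Subset using (Subset; ∣_∣; ⊥; ⁅_⁆; _─_; _∈_; inside; outside)
open import Data.Fin.Subset.Properties using (x∈⁅x⁆; x∈⁅y⁆⇒x≡y; ∉⊥; _∈?_; x∈p∧x∉q⇒x∈p─q; p─q⊆p; p─⊥≡p)
open import Data.Product using (Σ; ∃; _×_; _,_; proj₁; proj₂)
open import Data.Sum using (_⊎_; inj₁; inj₂)
open import Data.Vec using (_∷_; here; there)
import Data.Empty as Empty
open import Relation.Nullary using (¬_; yes; no; contradiction)
open import Relation.Binary.PropositionalEquality using (_≡_; _≢_; refl; sym; trans; cong; subst; module ≡-Reasoning)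

p─q≡⁅x⁆⇒x∈p : ∀ {N} {p q : Subset N} {x} → p ─ q ≡ ⁅ x ⁆ → x ∈ p
p─q≡⁅x⁆⇒x∈p {p = p} {q} {x} eq = p─q⊆p p q (subst (x ∈_) (sym eq) (x∈⁅x⁆ x))

p─q≡⁅y⁆∧x∈p∧x≢y⇒x∈q : ∀ {N} {p q : Subset N} {x y} → p ─ q ≡ ⁅ y ⁆ → x ∈ p → x ≢ y → x ∈ q
p─q≡⁅y⁆∧x∈p∧x≢y⇒x∈q {q = q} {x} {y} eq x∈p x≢y with x ∈? q
... | yes x∈q = x∈q
... | no  x∉q = contradiction (x∈⁅y⁆⇒x≡y y (subst (x ∈_) eq (x∈p∧x∉q⇒x∈p─q x∈p x∉q))) x≢y

TSSeq-source : ∀ {H P I J} → TSSeq H P I J → P I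
TSSeq-source (done pI)     = pI
TSSeq-source (step pI _ _) = pI

TSSeq-from-stuck : ∀ {H P I J} → (∀ {I′} → P I′ → ¬ TSStep H I I′) → TSSeq H P I J → I ≡ J
TSSeq-from-stuck stuck (done _)        = refl
TSSeq-from-stuck stuck (step _ s rest) = Empty.⊥-elim (stuck (TSSeq-source rest) s)

DdIS⇒IS-Power : ∀ {G d I} → DdIS G d I → IS (Power G (d ∸ 1)) I
DdIS⇒IS-Power dis u∈I v∈I (u≢v , close) = dis u∈I v∈I u≢v close

∣1+n-n∣≡1 : ∀ n → ∣ suc n - n ∣ ≡ 1
∣1+n-n∣≡1 n = trans (m≤n⇒∣n-m∣≡n∸m (n≤1+n n)) (m+n∸n≡m 1 n)

∣1+n-k∣≡1⇒k≡n : ∀ {n k} → k ≤ suc n → ∣ suc n - k ∣ ≡ 1 → k ≡ n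
∣1+n-k∣≡1⇒k≡n {n} {k} k≤1+n e = suc-injective (begin
  1 + k              ≡⟨ cong (_+ k) e ⟨
  ∣ suc n - k ∣ + k  ≡⟨ cong (_+ k) (m≤n⇒∣n-m∣≡n∸m k≤1+n) ⟩
  suc n ∸ k + k      ≡⟨ m∸n+n≡m k≤1+n ⟩
  suc n              ∎)
  where open ≡-Reasoning

module LevelGraph {N : ℕ} (h : Fin N → ℕ) where

  Level : Graph
  Level = record
    { n      = N
    ; Adj    = λ u v → ∣ h u - h v ∣ ≡ 1
    ; sym    = λ {u} {v} e → trans (∣-∣-comm (h v) (h u)) e
    ; irrefl = λ {u} e → 0≢1+n (trans (sym (∣n-n∣≡0 (h u))) e)
    }

  adj-down : ∀ {u w} → h u ≡ suc (h w) → Adj Level u w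
  adj-down {w = w} e = trans (cong ∣_- h w ∣ e) (∣1+n-n∣≡1 (h w))

  walk-height-gap : ∀ {t u v} → Walk Level t u v → ∣ h u - h v ∣ ≤ t
  walk-height-gap {u = u} here = ≤-reflexive (∣n-n∣≡0 (h u))
  walk-height-gap {suc t} {u} {v} (cons {w = w} uw wv) = ≤-trans (∣-∣-triangle (h u) (h w) (h v))
    (subst (λ s → s + ∣ h w - h v ∣ ≤ suc t) (sym uw) (s≤s (walk-height-gap wv)))

  spread⇒DdIS : ∀ {s S} → (∀ {u v} → u ∈ S → v ∈ S → u ≢ v → suc s ≤ ∣ h u - h v ∣) → DdIS Level (suc s) S
  spread⇒DdIS spread u∈S v∈S u≢v (t , t≤s , walk) =
    1+n≰n (≤-trans (spread u∈S v∈S u≢v) (≤-trans (walk-height-gap walk) t≤s))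

  descend : (∀ {u r} → h u ≡ suc r → ∃ λ w → h w ≡ r) →
            ∀ t {u} r → h u ≡ r + t → ∃ λ w → h w ≡ r × Walk Level t u w
  descend below zero    {u} r e = u , trans e (+-identityʳ r) , here
  descend below (suc t) {u} r e =
    let w , hw        = below u≡1+r+t
        v , hv , walk = descend below t r hw
    in  v , hv , cons (adj-down (trans u≡1+r+t (cong suc (sym hw)))) walk
    where
    u≡1+r+t : h u ≡ suc (r + t)
    u≡1+r+t = trans e (+-suc r t)

module Construction (k : ℕ) where

  m : ℕ
  m = suc (suc k)

  V : Set
  V = Fin (3 + m)

  pattern leaf₁   = fzero
  pattern leaf₂   = fsuc fzero
  pattern root    = fsuc (fsuc fzero)
  pattern spine i = fsuc (fsuc (fsuc i))

  height : V → ℕ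
  height leaf₁     = suc m
  height leaf₂     = suc m
  height root      = 0
  height (spine i) = suc (toℕ i)

  open LevelGraph height

  -- Levels 0, …, m are single vertices, so G is the path root, spine … with both leaves on its top.

  G : Graph
  G = Level

  height≤1+m : ∀ v → height v ≤ suc m
  height≤1+m leaf₁     = ≤-refl
  height≤1+m leaf₂     = ≤-refl
  height≤1+m root      = z≤n
  height≤1+m (spine i) = s≤s (≤-trans (n≤1+n (toℕ i)) (toℕ<n i))

  height-injective : ∀ {u v} → height u ≡ height v → height v ≤ m → u ≡ v
  height-injective {v = leaf₁}   _ v≤m = Empty.⊥-elim (1+n≰n v≤m)
  height-injective {v = leaf₂}   _ v≤m = Empty.⊥-elim (1+n≰n v≤m)
  height-injective {leaf₁} {spine j} e _ = Empty.⊥-elim (<-irrefl (sym (suc-injective e)) (toℕ<n j))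
  height-injective {leaf₂} {spine j} e _ = Empty.⊥-elim (<-irrefl (sym (suc-injective e)) (toℕ<n j))
  height-injective {root}    {root}    _ _ = refl
  height-injective {spine i} {spine j} e _ = cong spine (toℕ-injective (suc-injective e))

  level : ∀ r → r ≤ m → ∃ λ w → height w ≡ r
  level zero    _   = root , refl
  level (suc r) r<m = spine (fromℕ< r<m) , cong suc (toℕ-fromℕ< r<m)

  height-below : ∀ {u r} → height u ≡ suc r → ∃ λ w → height w ≡ r
  height-below {u} e = level _ (≤-pred (subst (_≤ suc m) e (height≤1+m u)))

  walk-down : ∀ t {u v} → height u ≡ height v + t → height v ≤ m → Walk G t u v
  walk-down t {u} {v} e v≤m =
    let w , hw , walk = descend height-below t (height v) e
    in  subst (Walk G t u) (height-injective hw v≤m) walk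

  gap-m⇒¬DdIS : ∀ {S u v} → DdIS G (suc m) S → u ∈ S → v ∈ S → height u ≡ height v + m → height v ≤ m → Empty.⊥
  gap-m⇒¬DdIS {v = v} dis u∈S v∈S e v≤m = dis u∈S v∈S u≢v (m , ≤-refl , walk-down m e v≤m)
    where
    u≢v : _ ≢ v
    u≢v refl = <-irrefl e (m<m+n (height v) z<s)

  I J : Subset (3 + m)
  I = inside  ∷ outside ∷ inside ∷ ⊥
  J = outside ∷ inside  ∷ inside ∷ ⊥

  ∈I : ∀ {u} → u ∈ I → u ≡ leaf₁ ⊎ u ≡ root
  ∈I here                     = inj₁ refl
  ∈I (there (there here))     = inj₂ refl
  ∈I (there (there (there p))) = Empty.⊥-elim (∉⊥ p)

  ∈J : ∀ {u} → u ∈ J → u ≡ leaf₂ ⊎ u ≡ root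
  ∈J (there here)             = inj₁ refl
  ∈J (there (there here))     = inj₂ refl
  ∈J (there (there (there p))) = Empty.⊥-elim (∉⊥ p)

  leaf-root-spread : ∀ {ℓ u v} → height ℓ ≡ suc m → u ≡ ℓ ⊎ u ≡ root → v ≡ ℓ ⊎ v ≡ root → u ≢ v →
                     suc m ≤ ∣ height u - height v ∣
  leaf-root-spread _  (inj₁ refl) (inj₁ refl) u≢v = Empty.⊥-elim (u≢v refl)
  leaf-root-spread hℓ (inj₁ refl) (inj₂ refl) _   = ≤-reflexive (sym (trans (∣-∣-identityʳ _) hℓ))
  leaf-root-spread hℓ (inj₂ refl) (inj₁ refl) _   = ≤-reflexive (sym hℓ)
  leaf-root-spread _  (inj₂ refl) (inj₂ refl) u≢v = Empty.⊥-elim (u≢v refl)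

  I-DdIS : DdIS G (suc m) I
  I-DdIS = spread⇒DdIS λ u∈I v∈I → leaf-root-spread refl (∈I u∈I) (∈I v∈I)

  J-DdIS : DdIS G (suc m) J
  J-DdIS = spread⇒DdIS λ u∈J v∈J → leaf-root-spread refl (∈J u∈J) (∈J v∈J)

  I-stuck : ∀ {I′} → DdIS G (suc m) I′ → ¬ TSStep G I I′
  I-stuck {I′} dis (x , y , I─I′≡x , I′─I≡y , x~y) = slide (∈I (p─q≡⁅x⁆⇒x∈p I─I′≡x)) x~y
    where
    y∈I′ : y ∈ I′
    y∈I′ = p─q≡⁅x⁆⇒x∈p I′─I≡y
    stays : ∀ {z} → z ∈ I → z ≢ x → z ∈ I′
    stays = p─q≡⁅y⁆∧x∈p∧x≢y⇒x∈q I─I′≡x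
    slide : x ≡ leaf₁ ⊎ x ≡ root → Adj G x y → Empty.⊥
    slide (inj₁ refl) x~y =
      gap-m⇒¬DdIS dis y∈I′ (stays (there (there here)) λ ()) (∣1+n-k∣≡1⇒k≡n (height≤1+m y) x~y) z≤n
    slide (inj₂ refl) x~y =
      gap-m⇒¬DdIS dis (stays here λ ()) y∈I′ (cong (_+ m) (sym x~y)) (subst (_≤ m) (sym x~y) (s≤s z≤n))

  I↛J : ¬ TSSeq G (DdIS G (suc m)) I J
  I↛J seq with TSSeq-from-stuck I-stuck seq
  ... | ()

  leaves-adjacent-in-power : Adj (Power G m) leaf₁ leaf₂
  leaves-adjacent-in-power = (λ ()) , 2 , s≤s (s≤s z≤n) , cons {w = w} leaf₁~w (cons w~leaf₂ here)
    where
    w : V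
    w = level m ≤-refl .proj₁
    hw : height w ≡ m
    hw = level m ≤-refl .proj₂
    leaf₁~w : Adj G leaf₁ w
    leaf₁~w = adj-down {leaf₁} {w} (cong suc (sym hw))
    w~leaf₂ : Adj G w leaf₂
    w~leaf₂ = Graph.sym G {leaf₂} {w} (adj-down {leaf₂} {w} (cong suc (sym hw)))

  I→J-in-power : TSSeq (Power G m) (IS (Power G m)) I J
  I→J-in-power = step (DdIS⇒IS-Power {d = suc m} I-DdIS) slide (done (DdIS⇒IS-Power {d = suc m} J-DdIS))
    where
    slide : TSStep (Power G m) I J
    slide = leaf₁ , leaf₂ , cong (λ p → inside ∷ outside ∷ outside ∷ p) (p─⊥≡p ⊥)
          , cong (λ p → outside ∷ inside ∷ outside ∷ p) (p─⊥≡p ⊥) , leaves-adjacent-in-power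

proposition2 : (d : ℕ) → 3 ≤ d →
    Σ Graph λ G → Σ (Subset (n G)) λ I → Σ (Subset (n G)) λ J →
    DdIS G d I × DdIS G d J × ∣ I ∣ ≡ ∣ J ∣ × 2 ≤ ∣ I ∣ ×
    ¬ TSSeq G (DdIS G d) I J ×
    TSSeq (Power G (d ∸ 1)) (IS (Power G (d ∸ 1))) I J
proposition2 (suc (suc (suc k))) (s≤s (s≤s (s≤s _))) =
  G , I , J , I-DdIS , J-DdIS , refl , s≤s (s≤s z≤n) , I↛J , I→J-in-power
  where open Construction k
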